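{- Let $p$ be an odd prime and let $c\in GF(p)\setminus\{0\}$ be a nonsquare if $p\equiv 1 \pmod 4$ and a nonzero square if $p\equiv 3\pmod 4$. For $k\in\{1,\dots,p-1\}$ let $O_k\subset PG(2,p)$ be the conic $x^2+ky^2+ckz^2=0$. Then no two distinct conics among $O_1,\dots,O_{p-1}$ have a tangent in common.
   Context: $PG(2,p)$ is the projective plane over $GF(p)$ with homogeneous coordinates. A tangent of a conic is a line meeting it in exactly one point. -}

module Defs where

open import Data.Nat using (ℕ; _+_; _*_; _<_)
open import Data.Product using (Σ; ∃; ∃₂; _×_; _,_)
open import Relation.Binary.PropositionalEquality using (_≡_)
open import Relation.Nullary using (¬_)

-- Elements of GF(p) are represented by natural numbers; equality in GF(p)
-- is congruence modulo p.
infix 4 _≋_[mod_]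
_≋_[mod_] : ℕ → ℕ → ℕ → Set
a ≋ b [mod p ] = Σ ℕ λ i → Σ ℕ λ j → a + i * p ≡ b + j * p

IsSquare : ℕ → ℕ → Set
IsSquare p c = ∃ λ t → t * t ≋ c [mod p ]

-- homogeneous coordinate triples
V3 : Set
V3 = ℕ × ℕ × ℕ

NonZeroV : ℕ → V3 → Set
NonZeroV p (x , y , z) = ¬ (x ≋ 0 [mod p ] × y ≋ 0 [mod p ] × z ≋ 0 [mod p ])

SamePoint : ℕ → V3 → V3 → Set
SamePoint p (x , y , z) (x' , y' , z') =
  ∃ λ l → ¬ (l ≋ 0 [mod p ]) ×
    (l * x ≋ x' [mod p ] × l * y ≋ y' [mod p ] × l * z ≋ z' [mod p ])

OnLine : ℕ → V3 → V3 → Set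
OnLine p (a , b , d) (x , y , z) = a * x + b * y + d * z ≋ 0 [mod p ]

OnConic : ℕ → ℕ → ℕ → V3 → Set
OnConic p c k (x , y , z) = x * x + k * (y * y) + c * k * (z * z) ≋ 0 [mod p ]

OnBoth : ℕ → ℕ → ℕ → V3 → V3 → Set
OnBoth p c k L v = NonZeroV p v × OnLine p L v × OnConic p c k v

Tangent : ℕ → ℕ → ℕ → V3 → Set
Tangent p c k L =
  NonZeroV p L ×
  (Σ V3 λ P → OnBoth p c k L P × (∀ Q → OnBoth p c k L Q → SamePoint p P Q))

module Submission where

-- Work in ℤ modulo p.  A tangent (a , b , d) of O_k touching it at P is the
-- polar line of P (Conic.Tangency.polar: otherwise the chord identity yields a
-- second common point), hence lies on the dual conic c k a² + c b² + d² = 0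
-- (Conic.tangent⇒dual).  A common tangent of O_k₁ and O_k₂ therefore has a = 0
-- and c b² + d² = 0, and since it is a nonzero line, -c = (d / b)² is a square
-- (DualConics).  This contradicts the hypotheses on c by Euler's criterion
-- (Character): for p = 2m + 1, pairing every unit x with E / x shows that the
-- product of all units is E^m when E is a nonsquare and -E^m when E is a
-- square (Euler.Pairing, Euler.Involution); with E = 1 this is Wilson's
-- theorem, so E^m = ±1 according as E is a (non)square (Euler.Criterion).  For
-- p ≡ 1 (mod 4) m is even, so c and -c have the same character; for
-- p ≡ 3 (mod 4) m is odd, so they have opposite characters.

open import Defs
open import Data.Nat using (ℕ; _<_; _≤_; _%_)
open import Data.Nat.Primality using (Prime)
open import Data.Product using (_×_)
open import Relation.Binary.PropositionalEquality using (_≡_; _≢_)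
open import Relation.Nullary using (¬_)

import Data.Nat as N
import Data.Nat.Properties as NP
import Data.Nat.DivMod as NDM
import Data.Nat.Divisibility as ND
open import Data.Nat.Primality using (prime⇒nonZero; prime⇒irreducible; prime⇒nonTrivial; euclidsLemma)
open import Data.Nat.Coprimality using (Coprime; coprime-Bézout)
open import Data.Nat.GCD using (module Bézout)
open import Data.Integer using (ℤ; +_; -[1+_]; _+_; _*_; -_; _-_; _^_; 0ℤ; 1ℤ; ∣_∣; _%ℕ_; _/ℕ_)
import Data.Integer.Properties as ZP
import Data.Integer.DivMod as ZDM
import Data.Integer.Divisibility.Signed as ZD
open import Data.Integer.Tactic.RingSolver using (solve-∀)
import Data.Nat.Tactic.RingSolver as NRS
open import Data.Product using (Σ; _,_; proj₁; proj₂)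
open import Data.Sum using (_⊎_; inj₁; inj₂; [_,_])
open import Data.Empty using (⊥; ⊥-elim)
open import Relation.Nullary using (Dec; yes; no)
open import Data.Bool using (Bool; true; false; if_then_else_)
open import Relation.Nullary.Decidable using (_×-dec_)
open import Relation.Binary.PropositionalEquality using (refl; sym; trans; cong; cong₂; subst; module ≡-Reasoning)

-- The embedding ℕ → ℤ.  It is opaque so that the ring solver treats ι n as an
-- atom and unification never unfolds integer arithmetic on it.
opaque
  ι : ℕ → ℤ
  ι n = + n

  ι≡+ : ∀ n → ι n ≡ + n
  ι≡+ n = refl

ι-+ : ∀ m n → ι (m N.+ n) ≡ ι m + ι n
ι-+ m n = trans (ι≡+ _) (trans (ZP.pos-+ m n) (sym (cong₂ _+_ (ι≡+ m) (ι≡+ n))))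

ι-* : ∀ m n → ι (m N.* n) ≡ ι m * ι n
ι-* m n = trans (ι≡+ _) (trans (ZP.pos-* m n) (sym (cong₂ _*_ (ι≡+ m) (ι≡+ n))))

ι-injective : ∀ {m n} → ι m ≡ ι n → m ≡ n
ι-injective {m} {n} e = ZP.+-injective (trans (sym (ι≡+ m)) (trans e (ι≡+ n)))

ι0 : ι 0 ≡ 0ℤ
ι0 = ι≡+ 0

ι1 : ι 1 ≡ 1ℤ
ι1 = ι≡+ 1

ι-minus-0 : ∀ a → ι a - ι 0 ≡ ι a
ι-minus-0 a = trans (cong (λ w → ι a - w) ι0) (ZP.+-identityʳ (ι a))

double-injective : ∀ {a b} → a N.+ a ≡ b N.+ b → a ≡ b
double-injective {N.zero}  {N.zero}  _ = refl
double-injective {N.suc a} {N.suc b} e =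
  cong N.suc (double-injective (NP.suc-injective (trans (sym (NP.+-suc a a)) (trans (NP.suc-injective e) (NP.+-suc b b)))))

difference : ∀ q → Σ ℕ λ i → Σ ℕ λ j → q ≡ ι i - ι j
difference (+ n)    = n , 0 , sym (trans (cong₂ _-_ (ι≡+ n) ι0) (ZP.+-identityʳ (+ n)))
difference -[1+ n ] = 0 , N.suc n , sym (cong₂ _-_ ι0 (ι≡+ (N.suc n)))

module Modular (p : ℕ) (prime : Prime p) where

  instance
    p≢0 : N.NonZero p
    p≢0 = prime⇒nonZero prime

  infix 4 _≈0 _≈_
  infixl 6 _⊕_
  infixr 7 _⊛_

  _≈0 : ℤ → Set
  x ≈0 = + p ZD.∣ x

  _≈_ : ℤ → ℤ → Set
  x ≈ y = x - y ≈0

  -- Vanishing is closed under ℤ-linear combinations; a claim e ≈0 is proved by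
  -- exhibiting e, via a ring identity, as a combination of vanishing terms.
  by : ∀ {e f} → e ≡ f → f ≈0 → e ≈0
  by refl h = h

  0≈0 : 0ℤ ≈0
  0≈0 = ZD.divides 0ℤ refl

  _⊕_ : ∀ {x y} → x ≈0 → y ≈0 → x + y ≈0
  _⊕_ = ZD.∣m∣n⇒∣m+n

  _⊛_ : ∀ r {x} → x ≈0 → r * x ≈0
  r ⊛ h = ZD.∣n⇒∣m*n r h

  ≈0-resp : ∀ {x y} → x ≈ y → x ≈0 → y ≈0
  ≈0-resp {x} {y} x≈y x≈0 = by (identity x y) (- 1ℤ ⊛ x≈y ⊕ x≈0)
    where
    identity : ∀ x y → y ≡ - 1ℤ * (x - y) + x
    identity = solve-∀

  ≈-sym : ∀ {x y} → x ≈ y → y ≈ x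
  ≈-sym {x} {y} h = by (negate x y) (- 1ℤ ⊛ h)
    where
    negate : ∀ x y → y - x ≡ - 1ℤ * (x - y)
    negate = solve-∀

  ≈-trans : ∀ {x y z} → x ≈ y → y ≈ z → x ≈ z
  ≈-trans {x} {y} {z} h h′ = by (split x y z) (h ⊕ h′)
    where
    split : ∀ x y z → x - z ≡ (x - y) + (y - z)
    split = solve-∀

  ≈0? : ∀ x → Dec (x ≈0)
  ≈0? x = + p ZD.∣? x

  euclid : ∀ x y → x * y ≈0 → x ≈0 ⊎ y ≈0
  euclid x y h with euclidsLemma ∣ x ∣ ∣ y ∣ prime (subst (p ND.∣_) (ZP.abs-* x y) (ZD.∣⇒∣ᵤ h))
  ... | inj₁ h′ = inj₁ (ZD.∣ᵤ⇒∣ h′)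
  ... | inj₂ h′ = inj₂ (ZD.∣ᵤ⇒∣ h′)

  cancel : ∀ {x y} → ¬ x ≈0 → x * y ≈0 → y ≈0
  cancel {x} {y} x≉0 h with euclid x y h
  ... | inj₁ x≈0 = ⊥-elim (x≉0 x≈0)
  ... | inj₂ y≈0 = y≈0

  nonzero-* : ∀ {x y} → ¬ x ≈0 → ¬ y ≈0 → ¬ x * y ≈0
  nonzero-* x≉0 y≉0 h = y≉0 (cancel x≉0 h)

  square≈0 : ∀ {x} → x * x ≈0 → x ≈0
  square≈0 {x} h with euclid x x h
  ... | inj₁ x≈0 = x≈0
  ... | inj₂ x≈0 = x≈0

  ≡⇒≈ : ∀ {x y} → x ≡ y → x ≈ y
  ≡⇒≈ {x} refl = by (self-diff x) 0≈0
    where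
    self-diff : ∀ x → x - x ≡ 0ℤ
    self-diff = solve-∀

  p≈0 : ι p ≈0
  p≈0 = subst _≈0 (sym (ι≡+ p)) ZD.∣-refl

  ≋⇒≈ : ∀ {a b} → a ≋ b [mod p ] → ι a ≈ ι b
  ≋⇒≈ {a} {b} (i , j , eq) =
    by (regroup (ι a) (ι b) (ι i) (ι j) (ι p))
       (≡⇒≈ (trans (image a i) (trans (cong ι eq) (sym (image b j)))) ⊕ (ι j - ι i) ⊛ p≈0)
    where
    image : ∀ a i → ι a + ι i * ι p ≡ ι (a N.+ i N.* p)
    image a i = sym (trans (ι-+ a (i N.* p)) (cong (λ w → ι a + w) (ι-* i p)))
    regroup : ∀ a b i j q → a - b ≡ (a + i * q) - (b + j * q) + (j - i) * q
    regroup = solve-∀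

  ≈⇒≋ : ∀ {a b} → ι a ≈ ι b → a ≋ b [mod p ]
  ≈⇒≋ {a} {b} (ZD.divides q eq) with difference q
  ... | i , j , refl = j , i , ι-injective (begin
      ι (a N.+ j N.* p)       ≡⟨ image a j ⟩
      ι a + ι j * ι p         ≡⟨ shift (ι a) (ι b) (ι i) (ι j) (ι p) ⟩
      (ι a - ι b) + ι b + ι j * ι p
        ≡⟨ cong (λ w → w + ι b + ι j * ι p) (trans eq (cong ((ι i - ι j) *_) (sym (ι≡+ p)))) ⟩
      (ι i - ι j) * ι p + ι b + ι j * ι p   ≡⟨ unshift (ι b) (ι i) (ι j) (ι p) ⟩
      ι b + ι i * ι p         ≡⟨ sym (image b i) ⟩
      ι (b N.+ i N.* p)       ∎)
    where
    open ≡-Reasoning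
    image : ∀ a i → ι (a N.+ i N.* p) ≡ ι a + ι i * ι p
    image a i = trans (ι-+ a (i N.* p)) (cong (λ w → ι a + w) (ι-* i p))
    shift : ∀ a b i j q → a + j * q ≡ (a - b) + b + j * q
    shift = solve-∀
    unshift : ∀ b i j q → (i - j) * q + b + j * q ≡ b + i * q
    unshift = solve-∀

  ≋0⇒≈0 : ∀ {a} → a ≋ 0 [mod p ] → ι a ≈0
  ≋0⇒≈0 {a} h = by (sym (ι-minus-0 a)) (≋⇒≈ h)

  ≈0⇒≋0 : ∀ {a} → ι a ≈0 → a ≋ 0 [mod p ]
  ≈0⇒≋0 {a} h = ≈⇒≋ (by (ι-minus-0 a) h)

  reduced-unique : ∀ {a b} → a < p → b < p → ι a ≈ ι b → a ≡ b
  reduced-unique {a} {b} a<p b<p h with ≈⇒≋ h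
  ... | i , j , eq = begin
      a                   ≡⟨ sym (NDM.m<n⇒m%n≡m a<p) ⟩
      a % p               ≡⟨ sym (NDM.[m+kn]%n≡m%n a i p) ⟩
      (a N.+ i N.* p) % p ≡⟨ cong (_% p) eq ⟩
      (b N.+ j N.* p) % p ≡⟨ NDM.[m+kn]%n≡m%n b j p ⟩
      b % p               ≡⟨ NDM.m<n⇒m%n≡m b<p ⟩
      b                   ∎
    where open ≡-Reasoning

  small≉0 : ∀ {a} → 0 < a → a < p → ¬ ι a ≈0
  small≉0 {a} 0<a a<p h with reduced-unique a<p (NP.<-trans 0<a a<p) (by (ι-minus-0 a) h)
  small≉0 (N.s≤s _) _ _ | ()

  opaque
    rep : ℤ → ℕ
    rep z = z %ℕ p

    rep< : ∀ z → rep z < p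
    rep< z = ZDM.n%ℕd<d z p

    rep≈ : ∀ z → ι (rep z) ≈ z
    rep≈ z = by (trans (cong (λ w → ι (rep z) - w) (ZDM.a≡a%ℕn+[a/ℕn]*n z p)) (expand (ι (rep z)) (+ rep z) (z /ℕ p) (+ p)))
                (- (z /ℕ p) ⊛ ZD.∣-refl ⊕ ≡⇒≈ (ι≡+ (rep z)))
      where
      expand : ∀ r r′ d q → r - (r′ + d * q) ≡ - d * q + (r - r′)
      expand = solve-∀

  rep-square : ∀ {t E} → t * t ≈ E → ι (rep t) * ι (rep t) ≈ E
  rep-square {t} {E} t²≈E = by (regroup (ι (rep t)) t E) ((ι (rep t) + t) ⊛ rep≈ t ⊕ t²≈E)
    where
    regroup : ∀ r t E → r * r - E ≡ (r + t) * (r - t) + (t * t - E)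
    regroup = solve-∀

  IsSquare⇒square : ∀ {c} → IsSquare p c → Σ ℤ λ t → t * t ≈ ι c
  IsSquare⇒square (t , t²≋c) = ι t , subst (λ e → e - _ ≈0) (ι-* t t) (≋⇒≈ t²≋c)

  square⇒IsSquare : ∀ {c t} → t * t ≈ ι c → IsSquare p c
  square⇒IsSquare {c} {t} t²≈c = rep t , ≈⇒≋ (subst (λ e → e - ι c ≈0) (sym (ι-* (rep t) (rep t))) (rep-square {t} t²≈c))

  inverse : ∀ x → ¬ x ≈0 → Σ ℤ λ y → x * y ≈ 1ℤ
  inverse x x≉0 with coprime-Bézout coprime
    where
    m = rep x
    coprime : Coprime m p
    coprime (d∣m , d∣p) with prime⇒irreducible prime d∣p
    ... | inj₁ d≡1 = d≡1
    ... | inj₂ refl = ⊥-elim (x≉0 (≈0-resp (rep≈ x) (subst _≈0 (sym (ι≡+ m)) (ZD.∣ᵤ⇒∣ d∣m))))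
  ... | Bézout.+- u v eq = ι u ,
    by (plus-case x (ι u) (ι (rep x)))
       (subst _≈0 (cong₂ _-_ (ι-* u (rep x)) ι1) (≋⇒≈ (0 , v , trans (NP.+-identityʳ _) (sym eq)))
        ⊕ - ι u ⊛ rep≈ x)
    where
    plus-case : ∀ x u r → x * u - 1ℤ ≡ (u * r - 1ℤ) + - u * (r - x)
    plus-case = solve-∀
  ... | Bézout.-+ u v eq = - ι u ,
    by (minus-case x (ι u) (ι (rep x)))
       (- 1ℤ ⊛ subst _≈0 (trans (ι-+ 1 (u N.* rep x)) (cong₂ _+_ ι1 (ι-* u (rep x))))
                        (≋0⇒≈0 (0 , v , trans (NP.+-identityʳ _) eq))
        ⊕ ι u ⊛ rep≈ x)
    where
    minus-case : ∀ x u r → x * - u - 1ℤ ≡ - 1ℤ * (1ℤ + u * r) + u * (r - x)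
    minus-case = solve-∀

  -- A total inverse function (with inv 0 = 0), opaque so it never unfolds.
  opaque
    inv : ℤ → ℤ
    inv x with ≈0? x
    ... | yes _   = 0ℤ
    ... | no x≉0 = proj₁ (inverse x x≉0)

    inv-correct : ∀ {x} → ¬ x ≈0 → x * inv x ≈ 1ℤ
    inv-correct {x} x≉0 with ≈0? x
    ... | yes x≈0 = ⊥-elim (x≉0 x≈0)
    ... | no x≉0′ = proj₂ (inverse x x≉0′)

  ≈-neg : ∀ {x y} → x ≈ y → - x ≈ - y
  ≈-neg {x} {y} h = by (negate x y) (- 1ℤ ⊛ h)
    where
    negate : ∀ x y → - x - - y ≡ - 1ℤ * (x - y)
    negate = solve-∀

  2≉0 : p ≢ 2 → ¬ + 2 ≈0
  2≉0 p≢2 h = small≉0 (N.s≤s N.z≤n) 2<p (subst _≈0 (sym (ι≡+ 2)) h)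
    where
    2<p : 2 < p
    2<p = NP.≤∧≢⇒< (N.nonTrivial⇒n>1 p {{prime⇒nonTrivial prime}}) (λ 2≡p → p≢2 (sym 2≡p))

module Conic (p : ℕ) (prime : Prime p) (c k : ℕ) where
  open Modular p prime

  C K : ℤ
  C = ι c
  K = ι k

  Q : ℤ → ℤ → ℤ → ℤ
  Q x y z = x * x + K * (y * y) + C * K * (z * z)

  Bil : ℤ → ℤ → ℤ → ℤ → ℤ → ℤ → ℤ
  Bil x y z u v w = x * u + K * (y * v) + C * K * (z * w)

  Lin : ℤ → ℤ → ℤ → ℤ → ℤ → ℤ → ℤ
  Lin a b d x y z = a * x + b * y + d * z

  ι-Lin : ∀ a b d x y z → ι (a N.* x N.+ b N.* y N.+ d N.* z) ≡ Lin (ι a) (ι b) (ι d) (ι x) (ι y) (ι z)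
  ι-Lin a b d x y z = trans (ι-+ (a N.* x N.+ b N.* y) (d N.* z))
    (cong₂ _+_ (trans (ι-+ (a N.* x) (b N.* y)) (cong₂ _+_ (ι-* a x) (ι-* b y))) (ι-* d z))

  ι-Q : ∀ x y z → ι (x N.* x N.+ k N.* (y N.* y) N.+ c N.* k N.* (z N.* z)) ≡ Q (ι x) (ι y) (ι z)
  ι-Q x y z = trans (ι-+ (x N.* x N.+ k N.* (y N.* y)) (c N.* k N.* (z N.* z)))
    (cong₂ _+_ (trans (ι-+ (x N.* x) (k N.* (y N.* y)))
                      (cong₂ _+_ (ι-* x x) (trans (ι-* k (y N.* y)) (cong (K *_) (ι-* y y)))))
               (trans (ι-* (c N.* k) (z N.* z)) (cong₂ _*_ (ι-* c k) (ι-* z z))))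

  onLine⇒ : ∀ {a b d x y z} → OnLine p (a , b , d) (x , y , z) → Lin (ι a) (ι b) (ι d) (ι x) (ι y) (ι z) ≈0
  onLine⇒ {a} {b} {d} {x} {y} {z} h = subst _≈0 (ι-Lin a b d x y z) (≋0⇒≈0 h)

  ⇒onLine : ∀ {a b d x y z} → Lin (ι a) (ι b) (ι d) (ι x) (ι y) (ι z) ≈0 → OnLine p (a , b , d) (x , y , z)
  ⇒onLine {a} {b} {d} {x} {y} {z} h = ≈0⇒≋0 (subst _≈0 (sym (ι-Lin a b d x y z)) h)

  onConic⇒ : ∀ {x y z} → OnConic p c k (x , y , z) → Q (ι x) (ι y) (ι z) ≈0
  onConic⇒ {x} {y} {z} h = subst _≈0 (ι-Q x y z) (≋0⇒≈0 h)

  ⇒onConic : ∀ {x y z} → Q (ι x) (ι y) (ι z) ≈0 → OnConic p c k (x , y , z)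
  ⇒onConic {x} {y} {z} h = ≈0⇒≋0 (subst _≈0 (sym (ι-Q x y z)) h)

  Lin-cong : ∀ a b d {x y z x′ y′ z′} → x′ ≈ x → y′ ≈ y → z′ ≈ z →
             Lin a b d x y z ≈0 → Lin a b d x′ y′ z′ ≈0
  Lin-cong a b d {x} {y} {z} {x′} {y′} {z′} ex ey ez h =
    by (expand a b d x y z x′ y′ z′) (a ⊛ ex ⊕ b ⊛ ey ⊕ d ⊛ ez ⊕ h)
    where
    expand : ∀ a b d x y z x′ y′ z′ →
      a * x′ + b * y′ + d * z′ ≡ a * (x′ - x) + b * (y′ - y) + d * (z′ - z) + (a * x + b * y + d * z)
    expand = solve-∀

  Q-cong : ∀ {x y z x′ y′ z′} → x′ ≈ x → y′ ≈ y → z′ ≈ z → Q x y z ≈0 → Q x′ y′ z′ ≈0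
  Q-cong {x} {y} {z} {x′} {y′} {z′} ex ey ez h =
    by (expand x y z x′ y′ z′ K C) ((x′ + x) ⊛ ex ⊕ (K * (y′ + y)) ⊛ ey ⊕ (C * K * (z′ + z)) ⊛ ez ⊕ h)
    where
    expand : ∀ x y z x′ y′ z′ K C →
      x′ * x′ + K * (y′ * y′) + C * K * (z′ * z′) ≡
      (x′ + x) * (x′ - x) + K * (y′ + y) * (y′ - y) + C * K * (z′ + z) * (z′ - z)
      + (x * x + K * (y * y) + C * K * (z * z))
    expand = solve-∀

  rep-onLine : ∀ {a b d s₁ s₂ s₃} → Lin (ι a) (ι b) (ι d) s₁ s₂ s₃ ≈0 → OnLine p (a , b , d) (rep s₁ , rep s₂ , rep s₃)
  rep-onLine {a} {b} {d} {s₁} {s₂} {s₃} h = ⇒onLine {a} {b} {d} {rep s₁} {rep s₂} {rep s₃}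
    (Lin-cong (ι a) (ι b) (ι d) {s₁} {s₂} {s₃} {ι (rep s₁)} {ι (rep s₂)} {ι (rep s₃)} (rep≈ s₁) (rep≈ s₂) (rep≈ s₃) h)

  rep-onConic : ∀ {s₁ s₂ s₃} → Q s₁ s₂ s₃ ≈0 → OnConic p c k (rep s₁ , rep s₂ , rep s₃)
  rep-onConic {s₁} {s₂} {s₃} h = ⇒onConic {rep s₁} {rep s₂} {rep s₃}
    (Q-cong {s₁} {s₂} {s₃} {ι (rep s₁)} {ι (rep s₂)} {ι (rep s₃)} (rep≈ s₁) (rep≈ s₂) (rep≈ s₃) h)

  -- The chord identity: the line through P and R meets the conic again at
  -- Q(R)·P - 2·B(P,R)·R, because Q restricted to that line is
  -- Q(g P - 2 b R) = g² Q(P) - 4 g b B(P,R) + 4 b² Q(R).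
  chord : ∀ x y z u v w g b →
    Q (g * x - + 2 * b * u) (g * y - + 2 * b * v) (g * z - + 2 * b * w) ≡
    g * g * Q x y z - + 4 * g * b * Bil x y z u v w + + 4 * b * b * Q u v w
  chord x y z u v w g b = identity x y z u v w K C g b
    where
    identity : ∀ x y z u v w K C g b →
      (g * x - + 2 * b * u) * (g * x - + 2 * b * u) + K * ((g * y - + 2 * b * v) * (g * y - + 2 * b * v))
      + C * K * ((g * z - + 2 * b * w) * (g * z - + 2 * b * w)) ≡
      g * g * (x * x + K * (y * y) + C * K * (z * z)) - + 4 * g * b * (x * u + K * (y * v) + C * K * (z * w))
      + + 4 * b * b * (u * u + K * (v * v) + C * K * (w * w))
    identity = solve-∀

  -- If P = (x , y , z) is the only point of PG(2,p) on both the line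
  -- (a , b , d) and O_k, the line is the polar of P: B(P,R) vanishes for
  -- every R on it.  Otherwise the chord identity would produce a second point.
  module Tangency (p≢2 : p ≢ 2) (a b d x y z : ℕ)
      (onL : OnLine p (a , b , d) (x , y , z)) (onC : OnConic p c k (x , y , z))
      (unique : ∀ R → OnBoth p c k (a , b , d) R → SamePoint p (x , y , z) R) where

    A B D X Y W : ℤ
    A = ι a
    B = ι b
    D = ι d
    X = ι x
    Y = ι y
    W = ι z

    polar : ∀ u v w → Lin A B D u v w ≈0 → Bil X Y W u v w ≈0
    polar u v w onR = square≈0 (cancel (2≉0 p≢2) (by (two-β² X Y W u v w K C μ) combination))
      where
      β = Bil X Y W u v w
      γ = Q u v w
      S₁ = γ * X - + 2 * β * u
      S₂ = γ * Y - + 2 * β * v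
      S₃ = γ * W - + 2 * β * w

      S-on-line : Lin A B D S₁ S₂ S₃ ≈0
      S-on-line = by (line-identity A B D X Y W u v w γ β) (γ ⊛ onLine⇒ onL ⊕ - (+ 2 * β) ⊛ onR)
        where
        line-identity : ∀ A B D X Y W u v w g b →
          A * (g * X - + 2 * b * u) + B * (g * Y - + 2 * b * v) + D * (g * W - + 2 * b * w) ≡
          g * (A * X + B * Y + D * W) + - (+ 2 * b) * (A * u + B * v + D * w)
        line-identity = solve-∀

      S-on-conic : Q S₁ S₂ S₃ ≈0
      S-on-conic = by (trans (chord X Y W u v w γ β) (collapse γ β (Q X Y W))) ((γ * γ) ⊛ onConic⇒ onC)
        where
        collapse : ∀ g b q → g * g * q - + 4 * g * b * b + + 4 * b * b * g ≡ (g * g) * q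
        collapse = solve-∀

      -- 2β·R is a multiple μ·P of P, whether or not the second point S is zero.
      Multiple : Set
      Multiple = Σ ℤ λ μ → (+ 2 * β * u - μ * X ≈0) × (+ 2 * β * v - μ * Y ≈0) × (+ 2 * β * w - μ * W ≈0)

      from-S≈0 : ∀ T t → γ * T - + 2 * β * t ≈0 → + 2 * β * t - γ * T ≈0
      from-S≈0 T t h = by (negate T t γ β) (- 1ℤ ⊛ h)
        where
        negate : ∀ T t g b → + 2 * b * t - g * T ≡ - 1ℤ * (g * T - + 2 * b * t)
        negate = solve-∀

      from-same-point : ∀ l (T : ℕ) t → l N.* T ≋ rep (γ * ι T - + 2 * β * t) [mod p ] →
                        + 2 * β * t - (γ - ι l) * ι T ≈0
      from-same-point l T t e =
        by (regroup (ι l) (ι T) (ι (rep S)) γ β t) (subst (λ m → m - ι (rep S) ≈0) (ι-* l T) (≋⇒≈ e) ⊕ rep≈ S)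
        where
        S = γ * ι T - + 2 * β * t
        regroup : ∀ l T r g b t → + 2 * b * t - (g - l) * T ≡ (l * T - r) + (r - (g * T - + 2 * b * t))
        regroup = solve-∀

      -- the second point S = (S₁ , S₂ , S₃) is on the line and the conic, so
      -- it is either zero or the point P itself
      S-nonzero : ¬ (S₁ ≈0 × S₂ ≈0 × S₃ ≈0) → NonZeroV p (rep S₁ , rep S₂ , rep S₃)
      S-nonzero S≉0 (h₁ , h₂ , h₃) =
        S≉0 (≈0-resp (rep≈ S₁) (≋0⇒≈0 h₁) , ≈0-resp (rep≈ S₂) (≋0⇒≈0 h₂) , ≈0-resp (rep≈ S₃) (≋0⇒≈0 h₃))

      S-line : OnLine p (a , b , d) (rep S₁ , rep S₂ , rep S₃)
      S-line = rep-onLine {a} {b} {d} {S₁} {S₂} {S₃} S-on-line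

      S-conic : OnConic p c k (rep S₁ , rep S₂ , rep S₃)
      S-conic = rep-onConic {S₁} {S₂} {S₃} S-on-conic

      from-S≈P : SamePoint p (x , y , z) (rep S₁ , rep S₂ , rep S₃) → Multiple
      from-S≈P (l , _ , e₁ , e₂ , e₃) =
        γ - ι l , from-same-point l x u e₁ , from-same-point l y v e₂ , from-same-point l z w e₃

      multiple-by-cases : Dec (S₁ ≈0 × S₂ ≈0 × S₃ ≈0) → Multiple
      multiple-by-cases (yes (h₁ , h₂ , h₃)) = γ , from-S≈0 X u h₁ , from-S≈0 Y v h₂ , from-S≈0 W w h₃
      multiple-by-cases (no S≉0) = from-S≈P (unique _ (S-nonzero S≉0 , S-line , S-conic))

      multiple : Multiple
      multiple = multiple-by-cases (≈0? S₁ ×-dec (≈0? S₂ ×-dec ≈0? S₃))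

      μ = proj₁ multiple

      combination : X * (+ 2 * β * u - μ * X) + K * Y * (+ 2 * β * v - μ * Y)
                    + C * K * W * (+ 2 * β * w - μ * W) + μ * Q X Y W ≈0
      combination = X ⊛ proj₁ (proj₂ multiple) ⊕ (K * Y) ⊛ proj₁ (proj₂ (proj₂ multiple))
                    ⊕ (C * K * W) ⊛ proj₂ (proj₂ (proj₂ multiple)) ⊕ μ ⊛ onConic⇒ onC

      two-β² : ∀ X Y W u v w K C m →
        + 2 * ((X * u + K * (Y * v) + C * K * (W * w)) * (X * u + K * (Y * v) + C * K * (W * w))) ≡
        X * (+ 2 * (X * u + K * (Y * v) + C * K * (W * w)) * u - m * X)
        + K * Y * (+ 2 * (X * u + K * (Y * v) + C * K * (W * w)) * v - m * Y)
        + C * K * W * (+ 2 * (X * u + K * (Y * v) + C * K * (W * w)) * w - m * W)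
        + m * (X * X + K * (Y * Y) + C * K * (W * W))
      two-β² = solve-∀

  -- The dual conic of O_k: a line (a , b , d) is tangent to O_k exactly when
  -- F(a,b,d) = c k a² + c b² + d² vanishes.  We need the "only if" half.
  F : ℤ → ℤ → ℤ → ℤ
  F a b d = C * K * (a * a) + C * (b * b) + d * d

  F-proportional : ∀ {a b d n₁ n₂ n₃} →
    n₁ * b - n₂ * a ≈0 → n₁ * d - n₃ * a ≈0 → n₂ * d - n₃ * b ≈0 →
    ¬ (n₁ ≈0 × n₂ ≈0 × n₃ ≈0) → F n₁ n₂ n₃ ≈0 → F a b d ≈0
  F-proportional {a} {b} {d} {n₁} {n₂} {n₃} e₁ e₂ e₃ n≉0 Fn≈0
    with ≈0? n₁ | ≈0? n₂ | ≈0? n₃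
  ... | no n₁≉0 | _ | _ = cancel (nonzero-* n₁≉0 n₁≉0)
    (by (first a b d n₁ n₂ n₃ K C) ((a * a) ⊛ Fn≈0 ⊕ (C * (n₁ * b + n₂ * a)) ⊛ e₁ ⊕ (n₁ * d + n₃ * a) ⊛ e₂))
    where
    first : ∀ a b d n₁ n₂ n₃ K C →
      (n₁ * n₁) * (C * K * (a * a) + C * (b * b) + d * d) ≡
      (a * a) * (C * K * (n₁ * n₁) + C * (n₂ * n₂) + n₃ * n₃)
      + (C * (n₁ * b + n₂ * a)) * (n₁ * b - n₂ * a) + (n₁ * d + n₃ * a) * (n₁ * d - n₃ * a)
    first = solve-∀
  ... | yes _ | no n₂≉0 | _ = cancel (nonzero-* n₂≉0 n₂≉0)
    (by (second a b d n₁ n₂ n₃ K C) ((b * b) ⊛ Fn≈0 ⊕ (- (C * K * (n₂ * a + n₁ * b))) ⊛ e₁ ⊕ (n₂ * d + n₃ * b) ⊛ e₃))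
    where
    second : ∀ a b d n₁ n₂ n₃ K C →
      (n₂ * n₂) * (C * K * (a * a) + C * (b * b) + d * d) ≡
      (b * b) * (C * K * (n₁ * n₁) + C * (n₂ * n₂) + n₃ * n₃)
      + (- (C * K * (n₂ * a + n₁ * b))) * (n₁ * b - n₂ * a) + (n₂ * d + n₃ * b) * (n₂ * d - n₃ * b)
    second = solve-∀
  ... | yes _ | yes _ | no n₃≉0 = cancel (nonzero-* n₃≉0 n₃≉0)
    (by (third a b d n₁ n₂ n₃ K C) ((d * d) ⊛ Fn≈0 ⊕ (- (C * K * (n₃ * a + n₁ * d))) ⊛ e₂ ⊕ (- (C * (n₃ * b + n₂ * d))) ⊛ e₃))
    where
    third : ∀ a b d n₁ n₂ n₃ K C →
      (n₃ * n₃) * (C * K * (a * a) + C * (b * b) + d * d) ≡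
      (d * d) * (C * K * (n₁ * n₁) + C * (n₂ * n₂) + n₃ * n₃)
      + (- (C * K * (n₃ * a + n₁ * d))) * (n₁ * d - n₃ * a) + (- (C * (n₃ * b + n₂ * d))) * (n₂ * d - n₃ * b)
    third = solve-∀
  ... | yes h₁ | yes h₂ | yes h₃ = ⊥-elim (n≉0 (h₁ , h₂ , h₃))

  -- A tangent of O_k satisfies the dual equation: by Tangency it is the polar
  -- line (x , k y , c k z) of its point of contact P, and F(x , k y , c k z) = c k Q(P).
  tangent⇒dual : p ≢ 2 → ¬ C ≈0 → ¬ K ≈0 → ∀ {a b d} → Tangent p c k (a , b , d) → F (ι a) (ι b) (ι d) ≈0
  tangent⇒dual p≢2 C≉0 K≉0 {a} {b} {d} (_ , (x , y , z) , (P≢0 , onL , onC) , unique) =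
    F-proportional
      (by (cross₁ A B D X Y W K C) (polar B (- A) 0ℤ (by (on₁ A B D) 0≈0)))
      (by (cross₂ A B D X Y W K C) (polar D 0ℤ (- A) (by (on₂ A B D) 0≈0)))
      (by (cross₃ A B D X Y W K C) (polar 0ℤ D (- B) (by (on₃ A B D) 0≈0)))
      normal≢0
      (by (normal-on-dual X Y W K C) ((C * K) ⊛ onConic⇒ onC))
    where
    open Tangency p≢2 a b d x y z onL onC unique
    normal≢0 : ¬ (X ≈0 × K * Y ≈0 × C * K * W ≈0)
    normal≢0 (X≈0 , KY≈0 , CKW≈0) =
      P≢0 (≈0⇒≋0 X≈0 , ≈0⇒≋0 (cancel K≉0 KY≈0) , ≈0⇒≋0 (cancel (nonzero-* C≉0 K≉0) CKW≈0))
    on₁ : ∀ A B D → A * B + B * - A + D * 0ℤ ≡ 0ℤ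
    on₁ = solve-∀
    on₂ : ∀ A B D → A * D + B * 0ℤ + D * - A ≡ 0ℤ
    on₂ = solve-∀
    on₃ : ∀ A B D → A * 0ℤ + B * D + D * - B ≡ 0ℤ
    on₃ = solve-∀
    cross₁ : ∀ A B D X Y W K C → X * B - K * Y * A ≡ X * B + K * (Y * - A) + C * K * (W * 0ℤ)
    cross₁ = solve-∀
    cross₂ : ∀ A B D X Y W K C → X * D - C * K * W * A ≡ X * D + K * (Y * 0ℤ) + C * K * (W * - A)
    cross₂ = solve-∀
    cross₃ : ∀ A B D X Y W K C → K * Y * D - C * K * W * B ≡ X * 0ℤ + K * (Y * D) + C * K * (W * - B)
    cross₃ = solve-∀
    normal-on-dual : ∀ X Y W K C →
      C * K * (X * X) + C * ((K * Y) * (K * Y)) + (C * K * W) * (C * K * W) ≡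
      (C * K) * (X * X + K * (Y * Y) + C * K * (W * W))
    normal-on-dual = solve-∀

Subset : Set
Subset = ℕ → Bool

opaque
  _∖_ : Subset → ℕ → Subset
  (S ∖ x) y with y N.≟ x
  ... | yes _ = false
  ... | no _  = S y

  ∖-self : ∀ (S : Subset) x → (S ∖ x) x ≡ false
  ∖-self S x with x N.≟ x
  ... | yes _   = refl
  ... | no x≢x = ⊥-elim (x≢x refl)

  ∖-other : ∀ (S : Subset) {x y} → y ≢ x → (S ∖ x) y ≡ S y
  ∖-other S {x} {y} y≢x with y N.≟ x
  ... | yes y≡x = ⊥-elim (y≢x y≡x)
  ... | no _    = refl

  ∖-member : ∀ (S : Subset) {x y} → (S ∖ x) y ≡ true → y ≢ x × S y ≡ true
  ∖-member S {x} {y} h with y N.≟ x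
  ... | no y≢x = y≢x , h

include : ℕ → ℤ × ℕ → ℤ × ℕ
include x (P , m) = ι x * P , N.suc m

tally : Subset → ℕ → ℤ × ℕ
tally S N.zero    = 1ℤ , 0
tally S (N.suc n) = if S n then include n (tally S n) else tally S n

tally-empty : ∀ (S : Subset) n → (∀ y → y < n → S y ≡ false) → tally S n ≡ (1ℤ , 0)
tally-empty S N.zero    none = refl
tally-empty S (N.suc n) none rewrite none n NP.≤-refl = tally-empty S n (λ y y<n → none y (NP.m<n⇒m<1+n y<n))

tally-below : ∀ (S : Subset) x n → n ≤ x → tally (S ∖ x) n ≡ tally S n
tally-below S x N.zero    _   = refl
tally-below S x (N.suc n) n<x rewrite ∖-other S {x} {n} (λ n≡x → NP.<⇒≢ n<x n≡x)
                                    | tally-below S x n (NP.<⇒≤ n<x) = refl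

include-swap : ∀ x y t → include x (include y t) ≡ include y (include x t)
include-swap x y (P , m) = cong (_, N.suc (N.suc m)) (swap (ι x) (ι y) P)
  where
  swap : ∀ a b c → a * (b * c) ≡ b * (a * c)
  swap = solve-∀

tally-∖ : ∀ (S : Subset) {x} n → x < n → S x ≡ true → tally S n ≡ include x (tally (S ∖ x) n)
tally-∖ S {x} (N.suc m) x<1+m x∈S with NP.m<1+n⇒m<n∨m≡n x<1+m
... | inj₂ refl rewrite x∈S | ∖-self S x | tally-below S x x NP.≤-refl = refl
... | inj₁ x<m rewrite ∖-other S {x} {m} (λ m≡x → NP.<⇒≢ x<m (sym m≡x)) with S m
...   | true  = trans (cong (include m) (tally-∖ S m x<m x∈S)) (include-swap m x _)
...   | false = tally-∖ S m x<m x∈S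

element? : ∀ (S : Subset) n → (Σ ℕ λ x → x < n × S x ≡ true) ⊎ (∀ y → y < n → S y ≡ false)
element? S N.zero = inj₂ (λ y ())
element? S (N.suc n) with element? S n
... | inj₁ (x , x<n , x∈S) = inj₁ (x , NP.m<n⇒m<1+n x<n , x∈S)
... | inj₂ none with S n in Sn
...   | true  = inj₁ (n , NP.≤-refl , Sn)
...   | false = inj₂ λ y y<1+n → below y (NP.m<1+n⇒m<n∨m≡n y<1+n)
  where
  below : ∀ y → y < n ⊎ y ≡ n → S y ≡ false
  below y (inj₁ y<n) = none y y<n
  below y (inj₂ refl) = Sn

module Euler (p : ℕ) (prime : Prime p) (p≢2 : p ≢ 2) where
  open Modular p prime

  product : Subset → ℤ
  product S = proj₁ (tally S p)

  size : Subset → ℕ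
  size S = proj₂ (tally S p)

  module Pairing (E : ℤ) (g : ℕ → ℕ) where

    Paired : Subset → Set
    Paired S = ∀ x → x < p → S x ≡ true →
      g x < p × S (g x) ≡ true × g x ≢ x × g (g x) ≡ x × ι x * ι (g x) ≈ E

    remove-pair : ∀ S {x} → x < p → S x ≡ true → Paired S →
      Paired ((S ∖ x) ∖ g x) × tally S p ≡ include x (include (g x) (tally ((S ∖ x) ∖ g x) p))
    remove-pair S {x} x<p x∈S paired with paired x x<p x∈S
    ... | gx<p , gx∈S , gx≢x , ggx≡x , _ =
      paired′ , trans (tally-∖ S p x<p x∈S) (cong (include x) (tally-∖ (S ∖ x) p gx<p (trans (∖-other S gx≢x) gx∈S)))
      where
      paired′ : Paired ((S ∖ x) ∖ g x)
      paired′ y y<p y∈S′ with ∖-member (S ∖ x) y∈S′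
      ... | y≢gx , y∈S∖x with ∖-member S y∈S∖x
      ...   | y≢x , y∈S with paired y y<p y∈S
      ...     | gy<p , gy∈S , gy≢y , ggy≡y , ygy≈E =
        gy<p , trans (∖-other (S ∖ x) gy≢gx) (trans (∖-other S gy≢x) gy∈S) , gy≢y , ggy≡y , ygy≈E
        where
        gy≢x : g y ≢ x
        gy≢x gy≡x = y≢gx (trans (sym ggy≡y) (cong g gy≡x))
        gy≢gx : g y ≢ g x
        gy≢gx gy≡gx = y≢x (trans (sym ggy≡y) (trans (cong g gy≡gx) ggx≡x))

    split-pair : ∀ S {n} → size S ≡ N.suc n → Paired S → Σ ℕ λ x →
      ι x * ι (g x) ≈ E × Paired ((S ∖ x) ∖ g x) × tally S p ≡ include x (include (g x) (tally ((S ∖ x) ∖ g x) p))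
    split-pair S |S|≡1+n paired with element? S p
    ... | inj₁ (x , x<p , x∈S) =
      x , proj₂ (proj₂ (proj₂ (proj₂ (paired x x<p x∈S)))) , remove-pair S x<p x∈S paired
    ... | inj₂ none with trans (sym (cong proj₂ (tally-empty S p none))) |S|≡1+n
    ...   | ()

    size-zero : ∀ S → size S ≡ 0 → product S ≡ 1ℤ
    size-zero S |S|≡0 with element? S p
    ... | inj₂ none = cong proj₁ (tally-empty S p none)
    ... | inj₁ (x , x<p , x∈S) with trans (sym (cong proj₂ (tally-∖ S p x<p x∈S))) |S|≡0
    ...   | ()

    paired-product : ∀ n S → size S ≡ n → Paired S → Σ ℕ λ j → n ≡ j N.+ j × product S ≈ E ^ j
    paired-product N.zero S |S|≡0 _ = 0 , refl , ≡⇒≈ (size-zero S |S|≡0)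
    paired-product (N.suc N.zero) S |S|≡1 paired with split-pair S |S|≡1 paired
    ... | _ , _ , _ , tally≡ with trans (sym (cong proj₂ tally≡)) |S|≡1
    ...   | ()
    paired-product (N.suc (N.suc n)) S |S|≡2+n paired with split-pair S |S|≡2+n paired
    ... | x , pair≈E , paired′ , tally≡
        with paired-product n _ (NP.suc-injective (NP.suc-injective (trans (sym (cong proj₂ tally≡)) |S|≡2+n))) paired′
    ...   | j , refl , prod≈ =
      N.suc j , cong N.suc (sym (NP.+-suc j j)) ,
      by (trans (cong (λ P → P - E ^ N.suc j) (cong proj₁ tally≡)) (regroup (ι x) (ι (g x)) _ (E ^ j) E))
         ((ι x * ι (g x)) ⊛ prod≈ ⊕ E ^ j ⊛ pair≈E)
      where
      regroup : ∀ a b P e E → a * (b * P) - E * e ≡ (a * b) * (P - e) + e * (a * b - E)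
      regroup = solve-∀

  units : Subset
  units = (λ _ → true) ∖ 0

  unit-intro : ∀ {x} → x ≢ 0 → units x ≡ true
  unit-intro x≢0 = ∖-other _ x≢0

  unit≉0 : ∀ {x} → x < p → units x ≡ true → ¬ ι x ≈0
  unit≉0 x<p x∈units = small≉0 (NP.n≢0⇒n>0 (proj₁ (∖-member _ x∈units))) x<p

  module Involution (E : ℤ) (E≉0 : ¬ E ≈0) where

    g : ℕ → ℕ
    g x = rep (E * inv (ι x))

    g< : ∀ x → g x < p
    g< x = rep< (E * inv (ι x))

    module _ {x} (x<p : x < p) (x∈units : units x ≡ true) where

      g-pair : ι x * ι (g x) ≈ E
      g-pair = by (regroup (ι x) (ι (g x)) E (inv (ι x)))
                  (ι x ⊛ rep≈ (E * inv (ι x)) ⊕ E ⊛ inv-correct (unit≉0 x<p x∈units))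
        where
        regroup : ∀ x y E i → x * y - E ≡ x * (y - E * i) + E * (x * i - 1ℤ)
        regroup = solve-∀

      g-unit : units (g x) ≡ true
      g-unit = unit-intro λ gx≡0 →
        E≉0 (≈0-resp g-pair (ι x ⊛ subst (λ y → ι y ≈0) (sym gx≡0) (by ι0 0≈0)))

      g-involutive : g (g x) ≡ x
      g-involutive = reduced-unique (g< (g x)) x<p
        (by (regroup (ι (g (g x))) E i (ι x) (ι (g x)))
            (rep≈ (E * i) ⊕ - i ⊛ g-pair ⊕ ι x ⊛ inv-correct (unit≉0 (g< x) g-unit)))
        where
        i = inv (ι (g x))
        regroup : ∀ z E i x y → z - x ≡ (z - E * i) + - i * (x * y - E) + x * (y * i - 1ℤ)
        regroup = solve-∀

      g-fixed : g x ≡ x → ι x * ι x ≈ E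
      g-fixed gx≡x = subst (λ y → ι x * ι y ≈ E) gx≡x g-pair

      root-fixed : ι x * ι x ≈ E → g x ≡ x
      root-fixed x²≈E = reduced-unique (g< x) x<p
        (by (regroup (ι (g x)) E (inv (ι x)) (ι x))
            (rep≈ (E * inv (ι x)) ⊕ - inv (ι x) ⊛ x²≈E ⊕ ι x ⊛ inv-correct (unit≉0 x<p x∈units)))
        where
        regroup : ∀ z E i x → z - x ≡ (z - E * i) + - i * (x * x - E) + x * (x * i - 1ℤ)
        regroup = solve-∀

    nonsquare-product : (∀ t → ¬ t * t ≈ E) → Σ ℕ λ j → size units ≡ j N.+ j × product units ≈ E ^ j
    nonsquare-product no-root = paired-product (size units) units refl paired
      where
      open Pairing E g
      paired : Paired units
      paired x x<p x∈units = g< x , g-unit x<p x∈units ,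
        (λ gx≡x → no-root (ι x) (g-fixed x<p x∈units gx≡x)) , g-involutive x<p x∈units , g-pair x<p x∈units

    -- If E = s², the fixed points of g are s and -s, with product -E; g pairs
    -- up the remaining units.
    module Root (s : ℤ) (s²≈E : s * s ≈ E) where

      -s²≈E : - s * - s ≈ E
      -s²≈E = by (cong (_- E) (square-neg s)) s²≈E
        where
        square-neg : ∀ s → - s * - s ≡ s * s
        square-neg = solve-∀

      s₀ s₁ : ℕ
      s₀ = rep s
      s₁ = rep (- s)

      s≉0 : ¬ s ≈0
      s≉0 s≈0 = E≉0 (≈0-resp s²≈E (s ⊛ s≈0))

      s₀-unit : units s₀ ≡ true
      s₀-unit = unit-intro λ s₀≡0 → s≉0 (≈0-resp (rep≈ s) (subst (λ y → ι y ≈0) (sym s₀≡0) (by ι0 0≈0)))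

      s₁-unit : units s₁ ≡ true
      s₁-unit = unit-intro λ s₁≡0 → s≉0 (by (negate s) (- 1ℤ ⊛ ≈0-resp (rep≈ (- s)) (subst (λ y → ι y ≈0) (sym s₁≡0) (by ι0 0≈0))))
        where
        negate : ∀ s → s ≡ - 1ℤ * - s
        negate = solve-∀

      s₁≢s₀ : s₁ ≢ s₀
      s₁≢s₀ s₁≡s₀ = s≉0 (cancel (2≉0 p≢2) (by (regroup s (ι s₀) (ι s₁))
        (rep≈ (- s) ⊕ - 1ℤ ⊛ rep≈ s ⊕ - 1ℤ ⊛ ≡⇒≈ (cong ι s₁≡s₀))))
        where
        regroup : ∀ s a b → + 2 * s ≡ (b - - s) + - 1ℤ * (a - s) + - 1ℤ * (b - a)
        regroup = solve-∀

      roots : ∀ {x} → x < p → ι x * ι x ≈ E → x ≡ s₀ ⊎ x ≡ s₁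
      roots {x} x<p x²≈E = root-cases (euclid (ι x - s) (ι x - - s) (by (factor (ι x) s E) (x²≈E ⊕ - 1ℤ ⊛ s²≈E)))
        where
        factor : ∀ x s E → (x - s) * (x - - s) ≡ (x * x - E) + - 1ℤ * (s * s - E)
        factor = solve-∀
        root-cases : ι x - s ≈0 ⊎ ι x - - s ≈0 → x ≡ s₀ ⊎ x ≡ s₁
        root-cases (inj₁ x≈s)  =
          inj₁ (reduced-unique x<p (rep< s) (≈-trans {ι x} {s} {ι s₀} x≈s (≈-sym {ι s₀} {s} (rep≈ s))))
        root-cases (inj₂ x≈-s) =
          inj₂ (reduced-unique x<p (rep< (- s)) (≈-trans {ι x} { - s} {ι s₁} x≈-s (≈-sym {ι s₁} { - s} (rep≈ (- s)))))

      rest : Subset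
      rest = (units ∖ s₀) ∖ s₁

      rest-paired : Pairing.Paired E g rest
      rest-paired x x<p x∈rest with ∖-member (units ∖ s₀) x∈rest
      ... | x≢s₁ , x∈units∖s₀ with ∖-member units x∈units∖s₀
      ...   | x≢s₀ , x∈units =
        g< x , trans (∖-other (units ∖ s₀) gx≢s₁) (trans (∖-other units gx≢s₀) (g-unit x<p x∈units)) ,
        gx≢x , g-involutive x<p x∈units , g-pair x<p x∈units
        where
        -- g x is no fixed point y ≠ x of g, for then x = g (g x) = g y = y.
        not-fixed : ∀ {y} → y < p → units y ≡ true → ι y * ι y ≈ E → x ≢ y → g x ≢ y
        not-fixed y<p y∈units y²≈E x≢y gx≡y =
          x≢y (trans (sym (g-involutive x<p x∈units)) (trans (cong g gx≡y) (root-fixed y<p y∈units y²≈E)))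
        gx≢s₀ : g x ≢ s₀
        gx≢s₀ = not-fixed (rep< s) s₀-unit (rep-square {s} s²≈E) x≢s₀
        gx≢s₁ : g x ≢ s₁
        gx≢s₁ = not-fixed (rep< (- s)) s₁-unit (rep-square { - s} -s²≈E) x≢s₁
        gx≢x : g x ≢ x
        gx≢x gx≡x = [ x≢s₀ , x≢s₁ ] (roots x<p (g-fixed x<p x∈units gx≡x))

      tally-units : tally units p ≡ include s₀ (include s₁ (tally rest p))
      tally-units = trans (tally-∖ units p (rep< s) s₀-unit)
        (cong (include s₀) (tally-∖ (units ∖ s₀) p (rep< (- s)) (trans (∖-other units s₁≢s₀) s₁-unit)))

      square-product : Σ ℕ λ j → size units ≡ N.suc j N.+ N.suc j × product units ≈ - (E ^ N.suc j)
      square-product = with-rest (Pairing.paired-product E g (size rest) rest refl rest-paired)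
        where
        with-rest : (Σ ℕ λ j → size rest ≡ j N.+ j × product rest ≈ E ^ j) →
                    Σ ℕ λ j → size units ≡ N.suc j N.+ N.suc j × product units ≈ - (E ^ N.suc j)
        with-rest (j , |rest|≡2j , prod≈) =
          j , trans (cong proj₂ tally-units) (cong N.suc (trans (cong N.suc |rest|≡2j) (sym (NP.+-suc j j)))) ,
          by (trans (cong (λ P → P - - (E ^ N.suc j)) (cong proj₁ tally-units))
                    (regroup (ι s₀) (ι s₁) (product rest) (E ^ j) E s))
             ((ι s₀ * ι s₁) ⊛ prod≈ ⊕ E ^ j ⊛ (ι s₀ ⊛ rep≈ (- s) ⊕ - s ⊛ rep≈ s ⊕ - 1ℤ ⊛ s²≈E))
          where
          regroup : ∀ a b P e E s → a * (b * P) - - (E * e) ≡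
            (a * b) * (P - e) + e * (a * (b - - s) + - s * (a - s) + - 1ℤ * (s * s - E))
          regroup = solve-∀

  units-size : N.suc (size units) ≡ p
  units-size = trans (cong proj₂ (sym (tally-∖ (λ _ → true) p 0<p refl))) (full-size p)
    where
    0<p : 0 < p
    0<p = NP.<-trans (N.s≤s N.z≤n) (N.nonTrivial⇒n>1 p {{prime⇒nonTrivial prime}})
    full-size : ∀ n → proj₂ (tally (λ _ → true) n) ≡ n
    full-size N.zero    = refl
    full-size (N.suc n) = cong N.suc (full-size n)

  module Criterion (m : ℕ) (p≡2m+1 : N.suc (m N.+ m) ≡ p) where

    half : ∀ {j} → size units ≡ j N.+ j → j ≡ m
    half {j} |units|≡2j = double-injective (NP.suc-injective (trans (cong N.suc (sym |units|≡2j)) (trans units-size (sym p≡2m+1))))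

    1≉0 : ¬ 1ℤ ≈0
    1≉0 h = small≉0 (N.s≤s N.z≤n) (N.nonTrivial⇒n>1 p {{prime⇒nonTrivial prime}}) (subst _≈0 (sym ι1) h)

    -- Wilson's theorem, the case E = s = 1.
    wilson : product units ≈ - 1ℤ
    wilson = let j , _ , prod≈ = Involution.Root.square-product 1ℤ 1≉0 1ℤ (≡⇒≈ {1ℤ * 1ℤ} {1ℤ} refl) in
      subst (λ e → product units ≈ - e) (ZP.^-zeroˡ (N.suc j)) prod≈

    euler-square : ∀ {E} → ¬ E ≈0 → ∀ s → s * s ≈ E → E ^ m ≈ 1ℤ
    euler-square {E} E≉0 s s²≈E =
      let j , |units|≡ , prod≈ = Involution.Root.square-product E E≉0 s s²≈E in
      subst (λ n → E ^ n ≈ 1ℤ) (half {N.suc j} |units|≡)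
        (by (regroup (E ^ N.suc j) (product units)) (prod≈ ⊕ - 1ℤ ⊛ wilson))
      where
      regroup : ∀ e w → e - 1ℤ ≡ (w - - e) + - 1ℤ * (w - - 1ℤ)
      regroup = solve-∀

    euler-nonsquare : ∀ {E} → ¬ E ≈0 → (∀ t → ¬ t * t ≈ E) → E ^ m ≈ - 1ℤ
    euler-nonsquare {E} E≉0 no-root =
      let j , |units|≡ , prod≈ = Involution.nonsquare-product E E≉0 no-root in
      subst (λ n → E ^ n ≈ - 1ℤ) (half {j} |units|≡)
        (≈-trans {E ^ j} {product units} { - 1ℤ} (≈-sym {product units} {E ^ j} prod≈) wilson)

neg-even : ∀ x q → (- x) ^ (q N.+ q) ≡ x ^ (q N.+ q)
neg-even x q = trans (ZP.^-distribˡ-+-* (- x) q q) (trans (squares q) (sym (ZP.^-distribˡ-+-* x q q)))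
  where
  regroup : ∀ x a → (- x * a) * (- x * a) ≡ (x * x) * (a * a)
  regroup = solve-∀
  unregroup : ∀ x a → (x * x) * (a * a) ≡ (x * a) * (x * a)
  unregroup = solve-∀
  squares : ∀ q → (- x) ^ q * (- x) ^ q ≡ x ^ q * x ^ q
  squares N.zero    = refl
  squares (N.suc q) = trans (regroup x ((- x) ^ q)) (trans (cong ((x * x) *_) (squares q)) (unregroup x (x ^ q)))

neg-odd : ∀ x q → (- x) ^ N.suc (q N.+ q) ≡ - (x ^ N.suc (q N.+ q))
neg-odd x q = trans (cong (- x *_) (neg-even x q)) (sym (ZP.neg-distribˡ-* x (x ^ (q N.+ q))))

-- The hypotheses on c force -c to be a nonsquare: for p = 4q+1, -1 is a
-- square, so -c is a nonsquare like c; for p = 4q+3, -1 is a nonsquare, so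
-- -c is a nonsquare while c is a square.
module Character (p : ℕ) (prime : Prime p) (p≢2 : p ≢ 2) where
  open Modular p prime
  open Euler p prime p≢2

  odd-prime-mod-4 : (p % 4 ≡ 1 × Σ ℕ λ q → N.suc ((q N.+ q) N.+ (q N.+ q)) ≡ p)
                  ⊎ (p % 4 ≡ 3 × Σ ℕ λ q → N.suc (N.suc (q N.+ q) N.+ N.suc (q N.+ q)) ≡ p)
  odd-prime-mod-4 = residue (p % 4) refl
    where
    q = p NDM./ 4
    p≡ : ∀ {r} → p % 4 ≡ r → p ≡ r N.+ q N.* 4
    p≡ e = trans (NDM.m≡m%n+[m/n]*n p 4) (cong (N._+ q N.* 4) e)
    odd : ∀ n → p ≢ 2 N.* n
    odd n p≡2n with prime⇒irreducible prime (ND.divides n (trans p≡2n (NP.*-comm 2 n)))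
    ... | inj₂ 2≡p = p≢2 (sym 2≡p)
    four-q   : ∀ q → q N.* 4 ≡ 2 N.* (q N.* 2)
    four-q   = NRS.solve-∀
    four-q+2 : ∀ q → 2 N.+ q N.* 4 ≡ 2 N.* (1 N.+ q N.* 2)
    four-q+2 = NRS.solve-∀
    four-q+1 : ∀ q → 1 N.+ q N.* 4 ≡ N.suc ((q N.+ q) N.+ (q N.+ q))
    four-q+1 = NRS.solve-∀
    four-q+3 : ∀ q → 3 N.+ q N.* 4 ≡ N.suc (N.suc (q N.+ q) N.+ N.suc (q N.+ q))
    four-q+3 = NRS.solve-∀
    residue : ∀ r → p % 4 ≡ r → (p % 4 ≡ 1 × Σ ℕ λ q → N.suc ((q N.+ q) N.+ (q N.+ q)) ≡ p)
                              ⊎ (p % 4 ≡ 3 × Σ ℕ λ q → N.suc (N.suc (q N.+ q) N.+ N.suc (q N.+ q)) ≡ p)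
    residue 0 e = ⊥-elim (odd (q N.* 2) (trans (p≡ e) (four-q q)))
    residue 1 e = inj₁ (e , q , sym (trans (p≡ e) (four-q+1 q)))
    residue 2 e = ⊥-elim (odd (1 N.+ q N.* 2) (trans (p≡ e) (four-q+2 q)))
    residue 3 e = inj₂ (e , q , sym (trans (p≡ e) (four-q+3 q)))
    residue (N.suc (N.suc (N.suc (N.suc r)))) e with subst (_< 4) e (NDM.m%n<n p 4)
    ... | N.s≤s (N.s≤s (N.s≤s (N.s≤s ())))

  -- Under the hypotheses of the theorem, Euler's criterion would give c^m both
  -- values ±1 (with p = 2m + 1) if -c were a square.
  -c-nonsquare : ∀ c → ¬ ι c ≈0 → (p % 4 ≡ 1 → ¬ IsSquare p c) → (p % 4 ≡ 3 → IsSquare p c) →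
                 ∀ t → ¬ t * t ≈ - ι c
  -c-nonsquare c c≉0 nonsquare₁ square₃ t t²≈-c = [ p≡1 , p≡3 ] odd-prime-mod-4
    where
    -c≉0 : ¬ - ι c ≈0
    -c≉0 h = c≉0 (by (negate (ι c)) (- 1ℤ ⊛ h))
      where
      negate : ∀ x → x ≡ - 1ℤ * - x
      negate = solve-∀
    contradiction : ∀ {m} → ι c ^ m ≈ 1ℤ → ι c ^ m ≈ - 1ℤ → ⊥
    contradiction {m} c^m≈1 c^m≈-1 =
      2≉0 p≢2 (≈-trans {1ℤ} {ι c ^ m} { - 1ℤ} (≈-sym {ι c ^ m} {1ℤ} c^m≈1) c^m≈-1)
    -- p = 4q + 1: m = 2q is even, so (-c)^m = c^m, while c is a nonsquare
    p≡1 : (p % 4 ≡ 1 × Σ ℕ λ q → N.suc ((q N.+ q) N.+ (q N.+ q)) ≡ p) → ⊥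
    p≡1 (e , q , p≡2m+1) = contradiction {q N.+ q}
      (subst (λ e → e ≈ 1ℤ) (neg-even (ι c) q) (euler-square -c≉0 t t²≈-c))
      (euler-nonsquare c≉0 λ u u²≈c → nonsquare₁ e (square⇒IsSquare {c} {u} u²≈c))
      where open Criterion (q N.+ q) p≡2m+1
    -- p = 4q + 3: m = 2q + 1 is odd, so (-c)^m = -c^m, while c is a square
    p≡3 : (p % 4 ≡ 3 × Σ ℕ λ q → N.suc (N.suc (q N.+ q) N.+ N.suc (q N.+ q)) ≡ p) → ⊥
    p≡3 (e , q , p≡2m+1) = contradiction {N.suc (q N.+ q)}
      (euler-square c≉0 (proj₁ √c) (proj₂ √c))
      (subst (λ e → e ≈ - 1ℤ) (ZP.neg-involutive (ι c ^ N.suc (q N.+ q)))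
         (≈-neg { - ι c ^ N.suc (q N.+ q)} {1ℤ} (subst (λ e → e ≈ 1ℤ) (neg-odd (ι c) q) (euler-square -c≉0 t t²≈-c))))
      where
      open Criterion (N.suc (q N.+ q)) p≡2m+1
      √c = IsSquare⇒square (square₃ e)

module DualConics (p : ℕ) (prime : Prime p) where
  open Modular p prime

  dual-difference : ∀ {C K₁ K₂ a b d} → ¬ C ≈0 → ¬ K₁ - K₂ ≈0 →
    C * K₁ * (a * a) + C * (b * b) + d * d ≈0 → C * K₂ * (a * a) + C * (b * b) + d * d ≈0 →
    a ≈0 × C * (b * b) + d * d ≈0
  dual-difference {C} {K₁} {K₂} {a} {b} {d} C≉0 K₁≉K₂ F₁≈0 F₂≈0 =
    a≈0 , by (drop-a C K₁ a b d) (F₁≈0 ⊕ - (C * K₁ * a) ⊛ a≈0)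
    where
    a≈0 : a ≈0
    a≈0 = square≈0 (cancel K₁≉K₂ (cancel C≉0 (by (subtract C K₁ K₂ a b d) (F₁≈0 ⊕ - 1ℤ ⊛ F₂≈0))))
      where
      subtract : ∀ C K₁ K₂ a b d → C * ((K₁ - K₂) * (a * a)) ≡
        (C * K₁ * (a * a) + C * (b * b) + d * d) + - 1ℤ * (C * K₂ * (a * a) + C * (b * b) + d * d)
      subtract = solve-∀
    drop-a : ∀ C K a b d → C * (b * b) + d * d ≡ (C * K * (a * a) + C * (b * b) + d * d) + - (C * K * a) * a
    drop-a = solve-∀

  -c-square : ∀ {C b d} → C * (b * b) + d * d ≈0 → ¬ (b ≈0 × d ≈0) → Σ ℤ λ t → t * t ≈ - C
  -c-square {C} {b} {d} conic≈0 bd≢0 with ≈0? b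
  ... | yes b≈0 = ⊥-elim (bd≢0 (b≈0 , square≈0 (by (drop-b C b d) (conic≈0 ⊕ - (C * b) ⊛ b≈0))))
    where
    drop-b : ∀ C b d → d * d ≡ (C * (b * b) + d * d) + - (C * b) * b
    drop-b = solve-∀
  ... | no b≉0 = d * inv b , by (quotient d (inv b) C b) ((inv b * inv b) ⊛ conic≈0 ⊕ - (C * (1ℤ + b * inv b)) ⊛ inv-correct b≉0)
    where
    quotient : ∀ d i C b → (d * i) * (d * i) - - C ≡ (i * i) * (C * (b * b) + d * d) + - (C * (1ℤ + b * i)) * (b * i - 1ℤ)
    quotient = solve-∀

mainTheorem4 : (p : ℕ) → Prime p → p ≢ 2 →
    (c : ℕ) → c < p → ¬ (c ≋ 0 [mod p ]) →
    (p % 4 ≡ 1 → ¬ IsSquare p c) → (p % 4 ≡ 3 → IsSquare p c) →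
    (k₁ k₂ : ℕ) → 1 ≤ k₁ → k₁ < p → 1 ≤ k₂ → k₂ < p → k₁ ≢ k₂ →
    (L : V3) → ¬ (Tangent p c k₁ L × Tangent p c k₂ L)
mainTheorem4 p prime p≢2 c _ c≢0 nonsquare₁ square₃ k₁ k₂ 0<k₁ k₁<p 0<k₂ k₂<p k₁≢k₂ (a , b , d) (T₁ , T₂) =
  Character.-c-nonsquare p prime p≢2 c c≉0 nonsquare₁ square₃ (proj₁ -c-is-square) (proj₂ -c-is-square)
  where
  open Modular p prime
  open DualConics p prime
  c≉0 : ¬ ι c ≈0
  c≉0 c≈0 = c≢0 (≈0⇒≋0 c≈0)
  k₁≉k₂ : ¬ ι k₁ - ι k₂ ≈0
  k₁≉k₂ k₁≈k₂ = k₁≢k₂ (reduced-unique k₁<p k₂<p k₁≈k₂)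
  dual : ∀ k → 0 < k → k < p → Tangent p c k (a , b , d) → Conic.F p prime c k (ι a) (ι b) (ι d) ≈0
  dual k 0<k k<p = Conic.tangent⇒dual p prime c k p≢2 c≉0 (small≉0 0<k k<p)
  common : ι a ≈0 × ι c * (ι b * ι b) + ι d * ι d ≈0
  common = dual-difference {ι c} {ι k₁} {ι k₂} {ι a} {ι b} {ι d} c≉0 k₁≉k₂ (dual k₁ 0<k₁ k₁<p T₁) (dual k₂ 0<k₂ k₂<p T₂)
  -c-is-square : Σ ℤ λ t → t * t ≈ - ι c
  -c-is-square = -c-square {ι c} {ι b} {ι d} (proj₂ common)
    λ (b≈0 , d≈0) → proj₁ T₁ (≈0⇒≋0 (proj₁ common) , ≈0⇒≋0 b≈0 , ≈0⇒≋0 d≈0)
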